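{- Under the Modified CFLS coloring $\varphi$ of $K_n$ ($n=2^{m^2}$), there are no five distinct vertices $a,b,c,d,e$ with $\varphi(bc)=\varphi(de)$, $\varphi(ad)=\varphi(cd)$ and $\varphi(ab)=\varphi(ac)$.
   Context: Let $m$ be a positive integer and $n=2^{m^2}$. The vertices of $K_n$ are the binary strings $v\in\{0,1\}^{m^2}$, written as $v=(v^{(1)},\dots,v^{(m)})$ with each block $v^{(k)}\in\{0,1\}^m$. Vertices (and blocks) are linearly ordered as binary integers: $x<y$ iff at the first bit where they differ, $x$ has 0 and $y$ has 1. For $x<y$, let $i$ be the first index with $x^{(i)}\ne y^{(i)}$; for $k\in[m]$ let $i_k$ be the first position at which the bits of $x^{(k)}$ and $y^{(k)}$ differ ($i_k=0$ if $x^{(k)}=y^{(k)}$), and let $\delta_k=+1$ if $x^{(k)}\le y^{(k)}$ and $\delta_k=-1$ if $x^{(k)}>y^{(k)}$. The Modified CFLS coloring assigns to edge $xy$ the color $\varphi(xy)=((i,\{x^{(i)},y^{(i)}\}),i_1,\dots,i_m,\delta_1,\dots,\delta_m)$. -}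

module Defs where

open import Data.Bool using (Bool; true; false; not; if_then_else_; _∧_)
open import Data.Bool.Properties using () renaming (_≟_ to _≟ᵇ_)
open import Data.Nat using (ℕ; zero; suc)
open import Data.Maybe using (Maybe; just; nothing)
open import Data.Product using (_×_; _,_)
open import Data.Vec using (Vec; []; _∷_; concat; zipWith)
open import Data.Vec.Properties using (≡-dec)
open import Relation.Nullary using (yes; no; ¬_)
open import Relation.Binary.PropositionalEquality using (_≡_; _≢_)

-- A block is a binary string of length m; a vertex of K_n (n = 2^(m^2)) is
-- a list of m blocks, i.e. v = (v^(1), ..., v^(m)), a binary string of length m^2.
Block : ℕ → Set
Block m = Vec Bool m

Vertex : ℕ → Set
Vertex m = Vec (Block m) m

ltBits : {k : ℕ} → Vec Bool k → Vec Bool k → Bool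
ltBits [] [] = false
ltBits (false ∷ xs) (false ∷ ys) = ltBits xs ys
ltBits (true ∷ xs) (true ∷ ys) = ltBits xs ys
ltBits (false ∷ xs) (true ∷ ys) = true
ltBits (true ∷ xs) (false ∷ ys) = false

ltV : {m : ℕ} → Vertex m → Vertex m → Bool
ltV x y = ltBits (concat x) (concat y)

-- 1-based index of the first position where two strings differ; 0 if equal.
bump : ℕ → ℕ
bump zero = zero
bump (suc j) = suc (suc j)

firstDiff : {k : ℕ} → Vec Bool k → Vec Bool k → ℕ
firstDiff [] [] = zero
firstDiff (a ∷ xs) (b ∷ ys) with a ≟ᵇ b
... | yes _ = bump (firstDiff xs ys)
... | no _ = suc zero

firstDiffBlock : {m k : ℕ} → Vec (Block m) k → Vec (Block m) k → Maybe (ℕ × Block m × Block m)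
firstDiffBlock [] [] = nothing
firstDiffBlock (a ∷ xs) (b ∷ ys) with ≡-dec _≟ᵇ_ a b
... | no _ = just (suc zero , a , b)
... | yes _ with firstDiffBlock xs ys
...   | nothing = nothing
...   | just (i , p , q) = just (suc i , p , q)

-- Colour type: ((i, {x^(i), y^(i)}), i_1..i_m, δ_1..δ_m).
-- The unordered pair {x^(i), y^(i)} is represented by the ordered pair
-- (x^(i), y^(i)) with x < y, which is its increasing enumeration
-- (x^(i) < y^(i) since i is the first differing block).
-- δ_k = +1 is encoded as true, δ_k = -1 as false.
Colour : ℕ → Set
Colour m = Maybe (ℕ × Block m × Block m) × Vec ℕ m × Vec Bool m

-- Colour of the pair (x, y) assuming x < y.
colourOrd : {m : ℕ} → Vertex m → Vertex m → Colour m
colourOrd x y =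
  firstDiffBlock x y ,
  zipWith firstDiff x y ,
  zipWith (λ p q → not (ltBits q p)) x y

φ : {m : ℕ} → Vertex m → Vertex m → Colour m
φ x y = if ltV x y then colourOrd x y else colourOrd y x

Distinct5 : {m : ℕ} → (a b c d e : Vertex m) → Set
Distinct5 a b c d e =
  a ≢ b × a ≢ c × a ≢ d × a ≢ e × b ≢ c × b ≢ d × b ≢ e × c ≢ d × c ≢ e × d ≢ e

{-# OPTIONS --safe #-}
module Submission where

open import Defs
open import Data.Nat using (ℕ; _<_; zero; suc)
open import Data.Nat.Properties using (suc-injective)
open import Data.Fin using (Fin; toℕ)
open import Data.Fin.Properties using (toℕ-injective)
open import Data.Product using (_×_; _,_; proj₁; proj₂; ∃-syntax)
open import Data.Product.Properties using (,-injective)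
open import Data.Sum using (_⊎_; inj₁; inj₂)
open import Data.Bool using (Bool; true; false)
open import Data.Bool.Properties using () renaming (_≟_ to _≟ᵇ_)
open import Data.Maybe using (just)
open import Data.Maybe.Properties using (just-injective)
open import Data.Vec using (Vec; []; _∷_; lookup; zipWith)
open import Data.Vec.Properties using (≡-dec; lookup-zipWith)
open import Data.Empty using (⊥-elim)
open import Relation.Nullary using (¬_; yes; no)
open import Relation.Binary.PropositionalEquality using (_≡_; _≢_; refl; sym; trans; cong)

-- Only the block i where b and c first differ matters. There φ(bc) = φ(de) forces
-- d^(i) ∈ {b^(i), c^(i)}, and the i_i-coordinates of φ(ab) = φ(ac) and φ(ad) = φ(cd)
-- give firstDiff α β = firstDiff α γ and firstDiff α δ = firstDiff γ δ for the
-- i-th blocks α, β, γ, δ of a, b, c, d. If δ = γ this makes α = γ and then α = β;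
-- if δ = β the three pairwise first differences of α, β, γ coincide, which over a
-- binary alphabet forces β = γ. Either way b^(i) = c^(i), a contradiction.

bump≢1 : ∀ n → bump n ≢ 1
bump≢1 zero ()
bump≢1 (suc n) ()

bump-injective : ∀ {n k} → bump n ≡ bump k → n ≡ k
bump-injective {zero}  {zero}  _ = refl
bump-injective {suc n} {suc k} refl = refl

firstDiff-self : ∀ {k} (x : Vec Bool k) → firstDiff x x ≡ 0
firstDiff-self []          = refl
firstDiff-self (true ∷ x)  = cong bump (firstDiff-self x)
firstDiff-self (false ∷ x) = cong bump (firstDiff-self x)

firstDiff≡0⇒≡ : ∀ {k} (x y : Vec Bool k) → firstDiff x y ≡ 0 → x ≡ y
firstDiff≡0⇒≡ []          []          _ = refl
firstDiff≡0⇒≡ (true ∷ x)  (true ∷ y)  e = cong (true ∷_) (firstDiff≡0⇒≡ x y (bump-injective e))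
firstDiff≡0⇒≡ (false ∷ x) (false ∷ y) e = cong (false ∷_) (firstDiff≡0⇒≡ x y (bump-injective e))

firstDiff-sym : ∀ {k} (x y : Vec Bool k) → firstDiff x y ≡ firstDiff y x
firstDiff-sym []          []          = refl
firstDiff-sym (true ∷ x)  (true ∷ y)  = cong bump (firstDiff-sym x y)
firstDiff-sym (false ∷ x) (false ∷ y) = cong bump (firstDiff-sym x y)
firstDiff-sym (true ∷ x)  (false ∷ y) = refl
firstDiff-sym (false ∷ x) (true ∷ y)  = refl

-- In the cases with distinct heads, two of the three heads agree (the alphabet is
-- binary), so one first difference is 1 and another is a bump.
firstDiff-equilateral : ∀ {k} (x y z : Vec Bool k) →
  firstDiff x y ≡ firstDiff x z → firstDiff x y ≡ firstDiff y z → y ≡ z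
firstDiff-equilateral [] [] [] _ _ = refl
firstDiff-equilateral (true ∷ x) (true ∷ y) (true ∷ z) e₁ e₂ =
  cong (true ∷_) (firstDiff-equilateral x y z (bump-injective e₁) (bump-injective e₂))
firstDiff-equilateral (false ∷ x) (false ∷ y) (false ∷ z) e₁ e₂ =
  cong (false ∷_) (firstDiff-equilateral x y z (bump-injective e₁) (bump-injective e₂))
firstDiff-equilateral (true  ∷ x) (true  ∷ y) (false ∷ z) e₁ _ = ⊥-elim (bump≢1 _ e₁)
firstDiff-equilateral (false ∷ x) (false ∷ y) (true  ∷ z) e₁ _ = ⊥-elim (bump≢1 _ e₁)
firstDiff-equilateral (true  ∷ x) (false ∷ y) (true  ∷ z) e₁ _ = ⊥-elim (bump≢1 _ (sym e₁))
firstDiff-equilateral (false ∷ x) (true  ∷ y) (false ∷ z) e₁ _ = ⊥-elim (bump≢1 _ (sym e₁))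
firstDiff-equilateral (true  ∷ x) (false ∷ y) (false ∷ z) _ e₂ = ⊥-elim (bump≢1 _ (sym e₂))
firstDiff-equilateral (false ∷ x) (true  ∷ y) (true  ∷ z) _ e₂ = ⊥-elim (bump≢1 _ (sym e₂))

firstDiff-collapse : ∀ {k} (α β γ δ : Vec Bool k) → δ ≡ β ⊎ δ ≡ γ →
  firstDiff α β ≡ firstDiff α γ → firstDiff α δ ≡ firstDiff γ δ → β ≡ γ
firstDiff-collapse α β γ .β (inj₁ refl) αβ≡αγ αβ≡γβ =
  firstDiff-equilateral α β γ αβ≡αγ (trans αβ≡γβ (firstDiff-sym γ β))
firstDiff-collapse α β γ .γ (inj₂ refl) αβ≡αγ αγ≡γγ = trans (sym α≡β) α≡γ
  where
  αγ≡0 : firstDiff α γ ≡ 0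
  αγ≡0 = trans αγ≡γγ (firstDiff-self γ)
  α≡γ : α ≡ γ
  α≡γ = firstDiff≡0⇒≡ α γ αγ≡0
  α≡β : α ≡ β
  α≡β = firstDiff≡0⇒≡ α β (trans αβ≡αγ αγ≡0)

firstDiffBlock-differ : ∀ {m k} (xs ys : Vec (Block m) k) → xs ≢ ys →
  ∃[ i ] lookup xs i ≢ lookup ys i ×
         firstDiffBlock xs ys ≡ just (suc (toℕ i) , lookup xs i , lookup ys i)
firstDiffBlock-differ [] [] []≢[] = ⊥-elim ([]≢[] refl)
firstDiffBlock-differ (x ∷ xs) (y ∷ ys) x∷xs≢y∷ys with ≡-dec _≟ᵇ_ x y
... | no x≢y = Fin.zero , x≢y , refl
... | yes refl with firstDiffBlock-differ xs ys (λ xs≡ys → x∷xs≢y∷ys (cong (x ∷_) xs≡ys))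
...   | i , xsᵢ≢ysᵢ , eq rewrite eq = Fin.suc i , xsᵢ≢ysᵢ , refl

firstBlock-injective : ∀ {m n} {i j : Fin n} {p q p′ q′ : Block m} →
  just (suc (toℕ i) , p , q) ≡ just (suc (toℕ j) , p′ , q′) →
  i ≡ j × p ≡ p′ × q ≡ q′
firstBlock-injective eq with ,-injective (just-injective eq)
... | i≡j , pq≡p′q′ with ,-injective pq≡p′q′
...   | p≡p′ , q≡q′ = toℕ-injective (suc-injective i≡j) , p≡p′ , q≡q′

φ-firstBlock : ∀ {m} (x y : Vertex m) → x ≢ y →
  ∃[ i ] lookup x i ≢ lookup y i ×
         (proj₁ (φ x y) ≡ just (suc (toℕ i) , lookup x i , lookup y i) ⊎
          proj₁ (φ x y) ≡ just (suc (toℕ i) , lookup y i , lookup x i))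
φ-firstBlock x y x≢y with ltV x y
... | true with firstDiffBlock-differ x y x≢y
...   | i , xᵢ≢yᵢ , eq = i , xᵢ≢yᵢ , inj₁ eq
φ-firstBlock x y x≢y | false with firstDiffBlock-differ y x (λ y≡x → x≢y (sym y≡x))
...   | i , yᵢ≢xᵢ , eq = i , (λ xᵢ≡yᵢ → yᵢ≢xᵢ (sym xᵢ≡yᵢ)) , inj₂ eq

φ-sharedFirstBlock : ∀ {m} (x y z w : Vertex m) → x ≢ y → z ≢ w →
  proj₁ (φ x y) ≡ proj₁ (φ z w) →
  ∃[ i ] lookup x i ≢ lookup y i × (lookup z i ≡ lookup x i ⊎ lookup z i ≡ lookup y i)
φ-sharedFirstBlock x y z w x≢y z≢w xy≡zw
  with φ-firstBlock x y x≢y | φ-firstBlock z w z≢w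
... | i , xᵢ≢yᵢ , inj₁ e₁ | j , _ , inj₁ e₂ with firstBlock-injective (trans (sym e₁) (trans xy≡zw e₂))
...   | refl , xᵢ≡zᵢ , _ = i , xᵢ≢yᵢ , inj₁ (sym xᵢ≡zᵢ)
φ-sharedFirstBlock x y z w x≢y z≢w xy≡zw
    | i , xᵢ≢yᵢ , inj₁ e₁ | j , _ , inj₂ e₂ with firstBlock-injective (trans (sym e₁) (trans xy≡zw e₂))
...   | refl , _ , yᵢ≡zᵢ = i , xᵢ≢yᵢ , inj₂ (sym yᵢ≡zᵢ)
φ-sharedFirstBlock x y z w x≢y z≢w xy≡zw
    | i , xᵢ≢yᵢ , inj₂ e₁ | j , _ , inj₁ e₂ with firstBlock-injective (trans (sym e₁) (trans xy≡zw e₂))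
...   | refl , yᵢ≡zᵢ , _ = i , xᵢ≢yᵢ , inj₂ (sym yᵢ≡zᵢ)
φ-sharedFirstBlock x y z w x≢y z≢w xy≡zw
    | i , xᵢ≢yᵢ , inj₂ e₁ | j , _ , inj₂ e₂ with firstBlock-injective (trans (sym e₁) (trans xy≡zw e₂))
...   | refl , _ , xᵢ≡zᵢ = i , xᵢ≢yᵢ , inj₁ (sym xᵢ≡zᵢ)

φ-firstDiff : ∀ {m} (x y : Vertex m) (i : Fin m) →
  lookup (proj₁ (proj₂ (φ x y))) i ≡ firstDiff (lookup x i) (lookup y i)
φ-firstDiff x y i with ltV x y
... | true  = lookup-zipWith firstDiff i x y
... | false = trans (lookup-zipWith firstDiff i y x) (firstDiff-sym (lookup y i) (lookup x i))

lemma11 : (m : ℕ) → 0 < m → (a b c d e : Vertex m) → Distinct5 a b c d e →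
    ¬ (φ b c ≡ φ d e × φ a d ≡ φ c d × φ a b ≡ φ a c)
lemma11 m _ a b c d e (_ , _ , _ , _ , b≢c , _ , _ , _ , _ , d≢e) (bc≡de , ad≡cd , ab≡ac)
  with φ-sharedFirstBlock b c d e b≢c d≢e (cong proj₁ bc≡de)
... | i , bᵢ≢cᵢ , dᵢ∈bᵢcᵢ =
  bᵢ≢cᵢ (firstDiff-collapse (lookup a i) (lookup b i) (lookup c i) (lookup d i)
           dᵢ∈bᵢcᵢ (firstDiffAt ab≡ac) (firstDiffAt ad≡cd))
  where
  firstDiffAt : ∀ {x y z w} → φ x y ≡ φ z w →
    firstDiff (lookup x i) (lookup y i) ≡ firstDiff (lookup z i) (lookup w i)
  firstDiffAt {x} {y} {z} {w} xy≡zw =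
    trans (sym (φ-firstDiff x y i))
          (trans (cong (λ col → lookup (proj₁ (proj₂ col)) i) xy≡zw) (φ-firstDiff z w i))
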